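{- Let $A$ be a BL-algebra satisfying the identity $x\odot x=x$ for all $x\in A$ (a Gödel BL-algebra). Then every state-operator $\sigma$ on $A$ is a BL-algebra endomorphism of $A$ (in particular $\sigma(x\odot y)=\sigma(x)\odot\sigma(y)$ and $\sigma(x\to y)=\sigma(x)\to\sigma(y)$ for all $x,y\in A$).
   Context: A BL-algebra is an algebra $(A,\wedge,\vee,\odot,\to,0,1)$ of type $(2,2,2,2,0,0)$ such that $(A,\wedge,\vee,0,1)$ is a bounded lattice, $(A,\odot,1)$ is a commutative monoid, and for all $a,b,c\in A$: $c\le a\to b$ iff $a\odot c\le b$; $a\wedge b=a\odot(a\to b)$; $(a\to b)\vee(b\to a)=1$. A state-operator on $A$ is a map $\sigma:A\to A$ such that for all $x,y\in A$: (1) $\sigma(0)=0$; (2) $\sigma(x\to y)=\sigma(x)\to\sigma(x\wedge y)$; (3) $\sigma(x\odot y)=\sigma(x)\odot\sigma(x\to x\odot y)$; (4) $\sigma(\sigma(x)\odot\sigma(y))=\sigma(x)\odot\sigma(y)$; (5) $\sigma(\sigma(x)\to\sigma(y))=\sigma(x)\to\sigma(y)$. -}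

module Defs where

open import Level using (Level; suc)
open import Data.Product using (_×_)
open import Relation.Binary.PropositionalEquality using (_≡_)

record BLAlgebra (a : Level) : Set (suc a) where
  infixr 6 _∧_ _∨_
  infixr 7 _⊙_
  infixr 5 _⇒_
  infix 4 _≤_
  field
    Carrier : Set a
    _∧_ _∨_ _⊙_ _⇒_ : Carrier → Carrier → Carrier
    𝟘 𝟙 : Carrier
    ∧-comm   : ∀ x y → x ∧ y ≡ y ∧ x
    ∧-assoc  : ∀ x y z → (x ∧ y) ∧ z ≡ x ∧ (y ∧ z)
    ∨-comm   : ∀ x y → x ∨ y ≡ y ∨ x
    ∨-assoc  : ∀ x y z → (x ∨ y) ∨ z ≡ x ∨ (y ∨ z)
    ∧-absorbs-∨ : ∀ x y → x ∧ (x ∨ y) ≡ x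
    ∨-absorbs-∧ : ∀ x y → x ∨ (x ∧ y) ≡ x
    𝟘-least  : ∀ x → 𝟘 ∧ x ≡ 𝟘
    𝟙-greatest : ∀ x → x ∧ 𝟙 ≡ x
    ⊙-comm   : ∀ x y → x ⊙ y ≡ y ⊙ x
    ⊙-assoc  : ∀ x y z → (x ⊙ y) ⊙ z ≡ x ⊙ (y ⊙ z)
    ⊙-identityʳ : ∀ x → x ⊙ 𝟙 ≡ x

  _≤_ : Carrier → Carrier → Set a
  x ≤ y = x ∧ y ≡ x

  field
    residuation₁ : ∀ x y z → z ≤ (x ⇒ y) → (x ⊙ z) ≤ y
    residuation₂ : ∀ x y z → (x ⊙ z) ≤ y → z ≤ (x ⇒ y)
    divisibility : ∀ x y → x ∧ y ≡ x ⊙ (x ⇒ y)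
    prelinearity : ∀ x y → (x ⇒ y) ∨ (y ⇒ x) ≡ 𝟙

IsGodel : ∀ {a} → BLAlgebra a → Set a
IsGodel A = ∀ x → x ⊙ x ≡ x
  where open BLAlgebra A

record IsStateOperator {a} (A : BLAlgebra a) (σ : BLAlgebra.Carrier A → BLAlgebra.Carrier A) : Set a where
  open BLAlgebra A
  field
    σ-𝟘 : σ 𝟘 ≡ 𝟘
    σ-⇒ : ∀ x y → σ (x ⇒ y) ≡ σ x ⇒ σ (x ∧ y)
    σ-⊙ : ∀ x y → σ (x ⊙ y) ≡ σ x ⊙ σ (x ⇒ x ⊙ y)
    σ-σ⊙ : ∀ x y → σ (σ x ⊙ σ y) ≡ σ x ⊙ σ y
    σ-σ⇒ : ∀ x y → σ (σ x ⇒ σ y) ≡ σ x ⇒ σ y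

record IsBLEndomorphism {a} (A : BLAlgebra a) (f : BLAlgebra.Carrier A → BLAlgebra.Carrier A) : Set a where
  open BLAlgebra A
  field
    pres-∧ : ∀ x y → f (x ∧ y) ≡ f x ∧ f y
    pres-∨ : ∀ x y → f (x ∨ y) ≡ f x ∨ f y
    pres-⊙ : ∀ x y → f (x ⊙ y) ≡ f x ⊙ f y
    pres-⇒ : ∀ x y → f (x ⇒ y) ≡ f x ⇒ f y
    pres-𝟘 : f 𝟘 ≡ 𝟘
    pres-𝟙 : f 𝟙 ≡ 𝟙

-- In a Gödel BL-algebra ⊙ coincides with ∧, so ⇒ is the Heyting implication and
-- axiom (3) of a state-operator reads σ (x ∧ y) ≡ σ x ∧ σ (x ⇒ y). Since y ≤ x ⇒ y,
-- this makes σ monotone and then a ∧-homomorphism; axiom (2) upgrades this to ⇒,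
-- and σ 𝟙 ≡ σ (𝟘 ⇒ 𝟘) ≡ 𝟙. For joins, prelinearity splits σ (x ∨ y) along
-- (x ⇒ y) ∨ (y ⇒ x) into σ ((x ∨ y) ∧ (x ⇒ y)) ≡ σ y and σ ((x ∨ y) ∧ (y ⇒ x)) ≡ σ x.
module Submission where

open import Level using (Level)
open import Defs
open import Relation.Binary.PropositionalEquality
open ≡-Reasoning

module BLAlgebraProperties {a} (A : BLAlgebra a) where
  open BLAlgebra A

  ∧-idem : ∀ x → x ∧ x ≡ x
  ∧-idem x = trans (cong (x ∧_) (sym (∨-absorbs-∧ x x))) (∧-absorbs-∨ x (x ∧ x))

  ≤-refl : ∀ {x} → x ≤ x
  ≤-refl {x} = ∧-idem x

  ≤-trans : ∀ {x y z} → x ≤ y → y ≤ z → x ≤ z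
  ≤-trans {x} {y} {z} x≤y y≤z = begin
    x ∧ z       ≡⟨ cong (_∧ z) (sym x≤y) ⟩
    (x ∧ y) ∧ z ≡⟨ ∧-assoc x y z ⟩
    x ∧ (y ∧ z) ≡⟨ cong (x ∧_) y≤z ⟩
    x ∧ y       ≡⟨ x≤y ⟩
    x           ∎

  ≤-antisym : ∀ {x y} → x ≤ y → y ≤ x → x ≡ y
  ≤-antisym {x} {y} x≤y y≤x = trans (sym x≤y) (trans (∧-comm x y) y≤x)

  ≤-respˡ : ∀ {x x′ y} → x ≡ x′ → x ≤ y → x′ ≤ y
  ≤-respˡ refl x≤y = x≤y

  ≤-respʳ : ∀ {x y y′} → y ≡ y′ → x ≤ y → x ≤ y′
  ≤-respʳ refl x≤y = x≤y

  x≤𝟙 : ∀ x → x ≤ 𝟙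
  x≤𝟙 = 𝟙-greatest

  x∧y≤x : ∀ x y → x ∧ y ≤ x
  x∧y≤x x y = begin
    (x ∧ y) ∧ x ≡⟨ ∧-assoc x y x ⟩
    x ∧ (y ∧ x) ≡⟨ cong (x ∧_) (∧-comm y x) ⟩
    x ∧ (x ∧ y) ≡⟨ sym (∧-assoc x x y) ⟩
    (x ∧ x) ∧ y ≡⟨ cong (_∧ y) (∧-idem x) ⟩
    x ∧ y       ∎

  x∧y≤y : ∀ x y → x ∧ y ≤ y
  x∧y≤y x y = trans (∧-assoc x y y) (cong (x ∧_) (∧-idem y))

  ∧-greatest : ∀ {x y z} → z ≤ x → z ≤ y → z ≤ x ∧ y
  ∧-greatest {x} {y} {z} z≤x z≤y = begin
    z ∧ (x ∧ y) ≡⟨ sym (∧-assoc z x y) ⟩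
    (z ∧ x) ∧ y ≡⟨ cong (_∧ y) z≤x ⟩
    z ∧ y       ≡⟨ z≤y ⟩
    z           ∎

  ∧-monoʳ : ∀ x {y z} → y ≤ z → x ∧ y ≤ x ∧ z
  ∧-monoʳ x y≤z = ∧-greatest (x∧y≤x _ _) (≤-trans (x∧y≤y _ _) y≤z)

  x≤x∨y : ∀ x y → x ≤ x ∨ y
  x≤x∨y = ∧-absorbs-∨

  y≤x∨y : ∀ x y → y ≤ x ∨ y
  y≤x∨y x y = ≤-respʳ (∨-comm y x) (x≤x∨y y x)

  x≤y⇒x∨y≡y : ∀ {x y} → x ≤ y → x ∨ y ≡ y
  x≤y⇒x∨y≡y {x} {y} x≤y = begin
    x ∨ y       ≡⟨ cong (_∨ y) (sym x≤y) ⟩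
    (x ∧ y) ∨ y ≡⟨ ∨-comm _ _ ⟩
    y ∨ (x ∧ y) ≡⟨ cong (y ∨_) (∧-comm x y) ⟩
    y ∨ (y ∧ x) ≡⟨ ∨-absorbs-∧ y x ⟩
    y           ∎

  x∨y≡y⇒x≤y : ∀ {x y} → x ∨ y ≡ y → x ≤ y
  x∨y≡y⇒x≤y {x} {y} x∨y≡y = trans (cong (x ∧_) (sym x∨y≡y)) (∧-absorbs-∨ x y)

  ∨-least : ∀ {x y z} → x ≤ z → y ≤ z → x ∨ y ≤ z
  ∨-least {x} {y} {z} x≤z y≤z = x∨y≡y⇒x≤y (begin
    (x ∨ y) ∨ z ≡⟨ ∨-assoc x y z ⟩
    x ∨ (y ∨ z) ≡⟨ cong (x ∨_) (x≤y⇒x∨y≡y y≤z) ⟩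
    x ∨ z       ≡⟨ x≤y⇒x∨y≡y x≤z ⟩
    z           ∎)

  𝟙≤x⇒x : ∀ x → 𝟙 ≤ x ⇒ x
  𝟙≤x⇒x x = residuation₂ x x 𝟙 (≤-respˡ (sym (⊙-identityʳ x)) ≤-refl)

  x⇒x≡𝟙 : ∀ x → x ⇒ x ≡ 𝟙
  x⇒x≡𝟙 x = ≤-antisym (x≤𝟙 _) (𝟙≤x⇒x x)

  x⊙y≤x : ∀ x y → x ⊙ y ≤ x
  x⊙y≤x x y = residuation₁ x x y (≤-trans (x≤𝟙 y) (𝟙≤x⇒x x))

  x⊙y≤y : ∀ x y → x ⊙ y ≤ y
  x⊙y≤y x y = ≤-respˡ (⊙-comm y x) (x⊙y≤x y x)

  y≤x⇒y : ∀ x y → y ≤ x ⇒ y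
  y≤x⇒y x y = residuation₂ x y y (x⊙y≤y x y)

  ⊙-monoˡ : ∀ z {x y} → x ≤ y → x ⊙ z ≤ y ⊙ z
  ⊙-monoˡ z {x} {y} x≤y = ≤-respˡ (sym x⊙z≡y⊙z⊙[y⇒x]) (x⊙y≤x (y ⊙ z) (y ⇒ x))
    where
    x≡y⊙[y⇒x] : x ≡ y ⊙ (y ⇒ x)
    x≡y⊙[y⇒x] = trans (sym x≤y) (trans (∧-comm x y) (divisibility y x))

    x⊙z≡y⊙z⊙[y⇒x] : x ⊙ z ≡ (y ⊙ z) ⊙ (y ⇒ x)
    x⊙z≡y⊙z⊙[y⇒x] = begin
      x ⊙ z                ≡⟨ cong (_⊙ z) x≡y⊙[y⇒x] ⟩
      (y ⊙ (y ⇒ x)) ⊙ z    ≡⟨ ⊙-assoc _ _ _ ⟩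
      y ⊙ ((y ⇒ x) ⊙ z)    ≡⟨ cong (y ⊙_) (⊙-comm _ _) ⟩
      y ⊙ (z ⊙ (y ⇒ x))    ≡⟨ sym (⊙-assoc _ _ _) ⟩
      (y ⊙ z) ⊙ (y ⇒ x)    ∎

  ⊙-monoʳ : ∀ z {x y} → x ≤ y → z ⊙ x ≤ z ⊙ y
  ⊙-monoʳ z {x} {y} x≤y = ≤-respˡ (⊙-comm x z) (≤-respʳ (⊙-comm y z) (⊙-monoˡ z x≤y))

  x⇒[x∧y]≡x⇒y : ∀ x y → x ⇒ (x ∧ y) ≡ x ⇒ y
  x⇒[x∧y]≡x⇒y x y = ≤-antisym
    (residuation₂ x y _ (≤-trans (residuation₁ x (x ∧ y) _ ≤-refl) (x∧y≤y x y)))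
    (residuation₂ x (x ∧ y) _ (∧-greatest (x⊙y≤x x _) (residuation₁ x y _ ≤-refl)))

module GodelProperties {a} (A : BLAlgebra a) (⊙-idem : IsGodel A) where
  open BLAlgebra A
  open BLAlgebraProperties A

  ⊙≡∧ : ∀ x y → x ⊙ y ≡ x ∧ y
  ⊙≡∧ x y = ≤-antisym
    (∧-greatest (x⊙y≤x x y) (x⊙y≤y x y))
    (≤-respˡ (⊙-idem (x ∧ y))
      (≤-trans (⊙-monoˡ (x ∧ y) (x∧y≤x x y)) (⊙-monoʳ x (x∧y≤y x y))))

  curry : ∀ {x y z} → x ∧ z ≤ y → z ≤ x ⇒ y
  curry {x} {y} {z} x∧z≤y = residuation₂ x y z (≤-respˡ (sym (⊙≡∧ x z)) x∧z≤y)

  uncurry : ∀ {x y z} → z ≤ x ⇒ y → x ∧ z ≤ y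
  uncurry {x} {y} {z} z≤x⇒y = ≤-respˡ (⊙≡∧ x z) (residuation₁ x y z z≤x⇒y)

  x∧[x⇒y]≡x∧y : ∀ x y → x ∧ (x ⇒ y) ≡ x ∧ y
  x∧[x⇒y]≡x∧y x y = trans (sym (⊙≡∧ x (x ⇒ y))) (sym (divisibility x y))

  -- Meets distribute over joins because x ∧_ has the right adjoint x ⇒_.
  ∧-distribˡ-∨ : ∀ x y z → x ∧ (y ∨ z) ≡ (x ∧ y) ∨ (x ∧ z)
  ∧-distribˡ-∨ x y z = ≤-antisym
    (uncurry (∨-least (curry (x≤x∨y _ _)) (curry (y≤x∨y _ _))))
    (∨-least (∧-monoʳ x (x≤x∨y y z)) (∧-monoʳ x (y≤x∨y y z)))

  [x∨y]∧[x⇒y]≡y : ∀ x y → (x ∨ y) ∧ (x ⇒ y) ≡ y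
  [x∨y]∧[x⇒y]≡y x y = begin
    (x ∨ y) ∧ (x ⇒ y)             ≡⟨ ∧-comm _ _ ⟩
    (x ⇒ y) ∧ (x ∨ y)             ≡⟨ ∧-distribˡ-∨ _ _ _ ⟩
    ((x ⇒ y) ∧ x) ∨ ((x ⇒ y) ∧ y) ≡⟨ cong₂ _∨_ (trans (∧-comm _ _) (x∧[x⇒y]≡x∧y x y))
                                               (trans (∧-comm _ _) (y≤x⇒y x y)) ⟩
    (x ∧ y) ∨ y                   ≡⟨ x≤y⇒x∨y≡y (x∧y≤y x y) ⟩
    y                             ∎

module StateOperatorProperties {a} (A : BLAlgebra a) (⊙-idem : IsGodel A)
  (σ : BLAlgebra.Carrier A → BLAlgebra.Carrier A) (isState : IsStateOperator A σ) where
  open BLAlgebra A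
  open BLAlgebraProperties A
  open GodelProperties A ⊙-idem
  open IsStateOperator isState

  σ[x∧y]≡σx∧σ[x⇒y] : ∀ x y → σ (x ∧ y) ≡ σ x ∧ σ (x ⇒ y)
  σ[x∧y]≡σx∧σ[x⇒y] x y = begin
    σ (x ∧ y)             ≡⟨ cong σ (sym (⊙≡∧ x y)) ⟩
    σ (x ⊙ y)             ≡⟨ σ-⊙ x y ⟩
    σ x ⊙ σ (x ⇒ x ⊙ y)   ≡⟨ ⊙≡∧ _ _ ⟩
    σ x ∧ σ (x ⇒ x ⊙ y)   ≡⟨ cong (λ t → σ x ∧ σ (x ⇒ t)) (⊙≡∧ x y) ⟩
    σ x ∧ σ (x ⇒ x ∧ y)   ≡⟨ cong (λ t → σ x ∧ σ t) (x⇒[x∧y]≡x⇒y x y) ⟩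
    σ x ∧ σ (x ⇒ y)       ∎

  σ-mono : ∀ {x y} → x ≤ y → σ x ≤ σ y
  σ-mono {x} {y} x≤y = ≤-respˡ σy∧σ[y⇒x]≡σx (x∧y≤x (σ y) (σ (y ⇒ x)))
    where
    σy∧σ[y⇒x]≡σx : σ y ∧ σ (y ⇒ x) ≡ σ x
    σy∧σ[y⇒x]≡σx = sym (trans (cong σ (trans (sym x≤y) (∧-comm x y))) (σ[x∧y]≡σx∧σ[x⇒y] y x))

  σ-homo-∧ : ∀ x y → σ (x ∧ y) ≡ σ x ∧ σ y
  σ-homo-∧ x y = ≤-antisym
    (∧-greatest (σ-mono (x∧y≤x x y)) (σ-mono (x∧y≤y x y)))
    (≤-respʳ (sym (σ[x∧y]≡σx∧σ[x⇒y] x y)) (∧-monoʳ (σ x) (σ-mono (y≤x⇒y x y))))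

  σ-homo-⇒ : ∀ x y → σ (x ⇒ y) ≡ σ x ⇒ σ y
  σ-homo-⇒ x y = begin
    σ (x ⇒ y)           ≡⟨ σ-⇒ x y ⟩
    σ x ⇒ σ (x ∧ y)     ≡⟨ cong (σ x ⇒_) (σ-homo-∧ x y) ⟩
    σ x ⇒ (σ x ∧ σ y)   ≡⟨ x⇒[x∧y]≡x⇒y (σ x) (σ y) ⟩
    σ x ⇒ σ y           ∎

  σ-homo-⊙ : ∀ x y → σ (x ⊙ y) ≡ σ x ⊙ σ y
  σ-homo-⊙ x y = begin
    σ (x ⊙ y)   ≡⟨ cong σ (⊙≡∧ x y) ⟩
    σ (x ∧ y)   ≡⟨ σ-homo-∧ x y ⟩
    σ x ∧ σ y   ≡⟨ sym (⊙≡∧ (σ x) (σ y)) ⟩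
    σ x ⊙ σ y   ∎

  σ-homo-𝟙 : σ 𝟙 ≡ 𝟙
  σ-homo-𝟙 = begin
    σ 𝟙         ≡⟨ cong σ (sym (x⇒x≡𝟙 𝟘)) ⟩
    σ (𝟘 ⇒ 𝟘)   ≡⟨ σ-homo-⇒ 𝟘 𝟘 ⟩
    σ 𝟘 ⇒ σ 𝟘   ≡⟨ x⇒x≡𝟙 (σ 𝟘) ⟩
    𝟙           ∎

  σ-homo-∨ : ∀ x y → σ (x ∨ y) ≡ σ x ∨ σ y
  σ-homo-∨ x y = begin
    σ (x ∨ y)                                               ≡⟨ sym (𝟙-greatest _) ⟩
    σ (x ∨ y) ∧ 𝟙                                           ≡⟨ cong (σ (x ∨ y) ∧_) (sym (prelinearity (σ x) (σ y))) ⟩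
    σ (x ∨ y) ∧ ((σ x ⇒ σ y) ∨ (σ y ⇒ σ x))                 ≡⟨ ∧-distribˡ-∨ _ _ _ ⟩
    (σ (x ∨ y) ∧ (σ x ⇒ σ y)) ∨ (σ (x ∨ y) ∧ (σ y ⇒ σ x))   ≡⟨ cong₂ _∨_ (σ[x∨y]∧[σx⇒σy]≡σy x y) σ[x∨y]∧[σy⇒σx]≡σx ⟩
    σ y ∨ σ x                                               ≡⟨ ∨-comm _ _ ⟩
    σ x ∨ σ y                                               ∎
    where
    σ[x∨y]∧[σx⇒σy]≡σy : ∀ x y → σ (x ∨ y) ∧ (σ x ⇒ σ y) ≡ σ y
    σ[x∨y]∧[σx⇒σy]≡σy x y = begin
      σ (x ∨ y) ∧ (σ x ⇒ σ y)   ≡⟨ cong (σ (x ∨ y) ∧_) (sym (σ-homo-⇒ x y)) ⟩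
      σ (x ∨ y) ∧ σ (x ⇒ y)     ≡⟨ sym (σ-homo-∧ (x ∨ y) (x ⇒ y)) ⟩
      σ ((x ∨ y) ∧ (x ⇒ y))     ≡⟨ cong σ ([x∨y]∧[x⇒y]≡y x y) ⟩
      σ y                       ∎

    σ[x∨y]∧[σy⇒σx]≡σx : σ (x ∨ y) ∧ (σ y ⇒ σ x) ≡ σ x
    σ[x∨y]∧[σy⇒σx]≡σx = trans (cong (λ t → σ t ∧ (σ y ⇒ σ x)) (∨-comm x y)) (σ[x∨y]∧[σx⇒σy]≡σy y x)

proposition4p9 : ∀ {a : Level} (A : BLAlgebra a) → IsGodel A →
    (σ : BLAlgebra.Carrier A → BLAlgebra.Carrier A) → IsStateOperator A σ →
    IsBLEndomorphism A σ
proposition4p9 A ⊙-idem σ isState = record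
  { pres-∧ = σ-homo-∧
  ; pres-∨ = σ-homo-∨
  ; pres-⊙ = σ-homo-⊙
  ; pres-⇒ = σ-homo-⇒
  ; pres-𝟘 = σ-𝟘
  ; pres-𝟙 = σ-homo-𝟙
  }
  where
  open StateOperatorProperties A ⊙-idem σ isState
  open IsStateOperator isState using (σ-𝟘)
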